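{- Let $\mathcal{L}$ be a language and $T$ an $\mathcal{L}$-theory with Skolem expansion $T_+$ in the language $\mathcal{L}_{\operatorname{Sk}}$. Let $t_1(x),\dots,t_n(x)$ be $\mathcal{L}_{\operatorname{Sk}}$-terms such that for every $i\le n$ there is an $\mathcal{L}_{\operatorname{Sk}}$-function symbol $f_i$ with $t_i(x)=f_i(x,t_1(x),\dots,t_{i-1}(x))$. Then there are an $\mathcal{L}$-formula $\varphi(x,y)$ and a uniform configuration $\chi(x,y)$, where $y=(y_1,\dots,y_n)$, such that $T_+\models\forall x\forall y\Big(\big(\varphi(x,y)\wedge\chi(x,y)\big)\leftrightarrow\bigwedge_{i=1}^n y_i=f_i(x,y_1,\dots,y_{i-1})\Big)$.
   Context: Skolem expansion: enumerate all $\mathcal{L}$-formulas $\theta_s(x,y)$ with $y$ a single variable as $(\theta_s)_{s<|\mathcal{L}|}$; let $\mathcal{L}_{\operatorname{Sk}}=\mathcal{L}\cup\{f_s:s<|\mathcal{L}|\}$ with $f_s$ a new function symbol of arity $|x|$ (the Skolem functions); $T_+=T\cup\{\forall x(\exists y\,\theta_s(x,y)\to\theta_s(x,f_s(x))):s<|\mathcal{L}|\}$. A uniform configuration is an $\mathcal{L}_{\operatorname{Sk}}$-formula that is a conjunction of equalities of the form $f(x_{i_1},\dots,x_{i_m})=x_{i_0}$ with $f$ a Skolem function symbol (i.e. in $\mathcal{L}_{\operatorname{Sk}}\setminus\mathcal{L}$) and $x_{i_j}$ variables. -}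

module Defs where

open import Level using (Level; Lift; _⊔_; Setω) renaming (suc to lsuc; zero to lzero)
open import Data.Nat using (ℕ; zero; suc; _+_)
open import Data.Fin using (Fin; zero; suc; toℕ; _↑ˡ_; _↑ʳ_; inject)
open import Data.Vec using (Vec; []; _∷_; _++_; tabulate)
open import Data.Sum using (_⊎_; inj₁; inj₂)
open import Data.Product using (Σ; _×_; _,_)
open import Data.Empty using (⊥)
open import Data.Unit using (⊤)
open import Relation.Binary.PropositionalEquality using (_≡_; subst)

record Language : Set₁ where
  field
    Func     : Set
    arity    : Func → ℕ
    Rel      : Set
    relArity : Rel → ℕ
open Language public

data Term (L : Language) (n : ℕ) : Set where
  var : Fin n → Term L n
  app : (f : Func L) → Vec (Term L n) (arity L f) → Term L n

infix  7 _≐_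
infixr 6 _∧'_
infixr 5 _∨'_
infixr 4 _⇒_ _⇔_

data Formula (L : Language) : ℕ → Set where
  ⊥'   : ∀ {n} → Formula L n
  ⊤'   : ∀ {n} → Formula L n
  _≐_  : ∀ {n} → Term L n → Term L n → Formula L n
  rel  : ∀ {n} (R : Rel L) → Vec (Term L n) (relArity L R) → Formula L n
  _⇒_  : ∀ {n} → Formula L n → Formula L n → Formula L n
  _∧'_ : ∀ {n} → Formula L n → Formula L n → Formula L n
  _∨'_ : ∀ {n} → Formula L n → Formula L n → Formula L n
  ∀'   : ∀ {n} → Formula L (suc n) → Formula L n   -- binds variable zero
  ∃'   : ∀ {n} → Formula L (suc n) → Formula L n   -- binds variable zero

_⇔_ : ∀ {L n} → Formula L n → Formula L n → Formula L n
φ ⇔ ψ = (φ ⇒ ψ) ∧' (ψ ⇒ φ)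

Sentence : Language → Set
Sentence L = Formula L 0

Theory : Language → Set₁
Theory L = Sentence L → Set

∀* : ∀ {L} k → Formula L k → Sentence L
∀* zero    φ = φ
∀* (suc k) φ = ∀* k (∀' φ)

⋀ : ∀ {L k} n → (Fin n → Formula L k) → Formula L k
⋀ zero    F = ⊤'
⋀ (suc n) F = F zero ∧' ⋀ n (λ i → F (suc i))

app≡ : ∀ {L n m} (f : Func L) → m ≡ arity L f → Vec (Term L n) m → Term L n
app≡ {L} {n} f eq v = app f (subst (Vec (Term L n)) eq v)

mutual
  substT : ∀ {L n k} → (Fin n → Term L k) → Term L n → Term L k
  substT σ (var i)    = σ i
  substT σ (app f ts) = app f (substTs σ ts)

  substTs : ∀ {L n k a} → (Fin n → Term L k) → Vec (Term L n) a → Vec (Term L k) a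
  substTs σ []       = []
  substTs σ (t ∷ ts) = substT σ t ∷ substTs σ ts

liftσ : ∀ {L n k} → (Fin n → Term L k) → Fin (suc n) → Term L (suc k)
liftσ σ zero    = var zero
liftσ σ (suc i) = substT (λ j → var (suc j)) (σ i)

substF : ∀ {L n k} → (Fin n → Term L k) → Formula L n → Formula L k
substF σ ⊥'        = ⊥'
substF σ ⊤'        = ⊤'
substF σ (t ≐ u)   = substT σ t ≐ substT σ u
substF σ (rel R ts) = rel R (substTs σ ts)
substF σ (φ ⇒ ψ)   = substF σ φ ⇒ substF σ ψ
substF σ (φ ∧' ψ)  = substF σ φ ∧' substF σ ψ
substF σ (φ ∨' ψ)  = substF σ φ ∨' substF σ ψ
substF σ (∀' φ)    = ∀' (substF (liftσ σ) φ)
substF σ (∃' φ)    = ∃' (substF (liftσ σ) φ)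

-- Skolem language L_Sk: one new function symbol f_θ of arity k for every
-- L-formula θ(x,y) with x = (x_1..x_k) and y a single variable
-- (y is de Bruijn variable zero, x_i is variable suc (i-1)).

LSk : Language → Language
LSk L = record
  { Func     = Func L ⊎ Σ ℕ (λ k → Formula L (suc k))
  ; arity    = ar
  ; Rel      = Rel L
  ; relArity = relArity L
  }
  where
  ar : Func L ⊎ Σ ℕ (λ k → Formula L (suc k)) → ℕ
  ar (inj₁ f)       = arity L f
  ar (inj₂ (k , _)) = k

mutual
  trT : ∀ {L n} → Term L n → Term (LSk L) n
  trT (var i)    = var i
  trT (app f ts) = app (inj₁ f) (trTs ts)

  trTs : ∀ {L n a} → Vec (Term L n) a → Vec (Term (LSk L) n) a
  trTs []       = []
  trTs (t ∷ ts) = trT t ∷ trTs ts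

trF : ∀ {L n} → Formula L n → Formula (LSk L) n
trF ⊥'         = ⊥'
trF ⊤'         = ⊤'
trF (t ≐ u)    = trT t ≐ trT u
trF (rel R ts) = rel R (trTs ts)
trF (φ ⇒ ψ)    = trF φ ⇒ trF ψ
trF (φ ∧' ψ)   = trF φ ∧' trF ψ
trF (φ ∨' ψ)   = trF φ ∨' trF ψ
trF (∀' φ)     = ∀' (trF φ)
trF (∃' φ)     = ∃' (trF φ)

skolemAxiom : ∀ {L} k → Formula L (suc k) → Sentence (LSk L)
skolemAxiom {L} k θ = ∀* k (∃' (trF θ) ⇒ substF σ (trF θ))
  where
  σ : Fin (suc k) → Term (LSk L) k
  σ zero    = app (inj₂ (k , θ)) (tabulate var)
  σ (suc i) = var i

data Skolem₊ {L : Language} (T : Theory L) : Theory (LSk L) where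
  base : ∀ {φ} → T φ → Skolem₊ T (trF φ)
  sk   : ∀ k (θ : Formula L (suc k)) → Skolem₊ T (skolemAxiom k θ)

data IsUniformConfig {L : Language} {k : ℕ} : Formula (LSk L) k → Set where
  uc⊤  : IsUniformConfig ⊤'
  ucEq : ∀ (s : Σ ℕ (λ j → Formula L (suc j)))
           (vs : Vec (Fin k) (arity (LSk L) (inj₂ s))) (v₀ : Fin k) →
         IsUniformConfig (app (inj₂ s) (Data.Vec.map var vs) ≐ var v₀)
  uc∧  : ∀ {φ ψ} → IsUniformConfig φ → IsUniformConfig ψ → IsUniformConfig (φ ∧' ψ)

record Structure (L : Language) (ℓ : Level) : Set (lsuc ℓ) where
  field
    Carrier : Set ℓ
    funI    : (f : Func L) → Vec Carrier (arity L f) → Carrier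
    relI    : (R : Rel L) → Vec Carrier (relArity L R) → Set ℓ
open Structure public

module _ {L : Language} {ℓ : Level} (M : Structure L ℓ) where

  ext : ∀ {n} → Carrier M → (Fin n → Carrier M) → Fin (suc n) → Carrier M
  ext a ρ zero    = a
  ext a ρ (suc i) = ρ i

  mutual
    evalT : ∀ {n} → (Fin n → Carrier M) → Term L n → Carrier M
    evalT ρ (var i)    = ρ i
    evalT ρ (app f ts) = funI M f (evalTs ρ ts)

    evalTs : ∀ {n a} → (Fin n → Carrier M) → Vec (Term L n) a → Vec (Carrier M) a
    evalTs ρ []       = []
    evalTs ρ (t ∷ ts) = evalT ρ t ∷ evalTs ρ ts

  Sat : ∀ {n} → Formula L n → (Fin n → Carrier M) → Set ℓ
  Sat ⊥'         ρ = Lift ℓ ⊥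
  Sat ⊤'         ρ = Lift ℓ ⊤
  Sat (t ≐ u)    ρ = evalT ρ t ≡ evalT ρ u
  Sat (rel R ts) ρ = relI M R (evalTs ρ ts)
  Sat (φ ⇒ ψ)    ρ = Sat φ ρ → Sat ψ ρ
  Sat (φ ∧' ψ)   ρ = Sat φ ρ × Sat ψ ρ
  Sat (φ ∨' ψ)   ρ = Sat φ ρ ⊎ Sat ψ ρ
  Sat (∀' φ)     ρ = (a : Carrier M) → Sat φ (ext a ρ)
  Sat (∃' φ)     ρ = Σ (Carrier M) (λ a → Sat φ (ext a ρ))

_⊨ₛ_ : ∀ {L ℓ} → Structure L ℓ → Sentence L → Set ℓ
M ⊨ₛ φ = Sat M φ (λ ())

_⊨_ : ∀ {L} → Theory L → Sentence L → Setω
_⊨_ {L} T φ = ∀ {ℓ} (M : Structure L ℓ) → (∀ ψ → T ψ → M ⊨ₛ ψ) → M ⊨ₛ φ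

record Σω (A : Set) (B : A → Setω) : Setω where
  constructor _,ω_
  field
    fst : A
    snd : B fst

-- Data for the lemma: x = variables 0..m-1, y_i = variable m + i in Fin (m + n)

xVars : ∀ {L} m n → Vec (Term L (m + n)) m
xVars m n = tabulate (λ i → var (i ↑ˡ n))

yPrefix : ∀ {L} m {n} (i : Fin n) → Vec (Term L (m + n)) (toℕ i)
yPrefix m i = tabulate (λ j → var (m ↑ʳ inject j))

-- Each conjunct y_i = f_i(x, y_1, …, y_{i-1}) is handled on its own. If f_i is a
-- symbol of L the conjunct is an L-formula and goes into φ; if f_i is a Skolem
-- symbol, the flipped equation f_i(x, y_1, …, y_{i-1}) = y_i is a uniform
-- configuration and goes into χ. The resulting equivalence holds in every
-- L_Sk-structure and for all values of y, so neither T₊ nor the terms t_i are used.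
module Submission where

open import Defs
open import Level using (lift; Setω)
open import Data.Nat using (ℕ; _+_; zero; suc)
open import Data.Fin using (Fin; toℕ; _↑ʳ_; _↑ˡ_; inject; zero; suc)
open import Data.Vec using (Vec; _++_; tabulate; map; []; _∷_)
open import Data.Vec.Properties using (map-++; tabulate-∘)
open import Data.Product using (_×_; _,_; proj₁; proj₂)
open import Data.Product.Function.NonDependent.Propositional using (_×-⇔_)
open import Data.Sum using (inj₁; inj₂)
open import Data.Unit using (tt)
open import Function using (_∘_)
open import Function.Bundles using (mk⇔; module Equivalence) renaming (_⇔_ to _⟺_)
open import Function.Properties.Equivalence using (⇔-setoid)
open import Relation.Binary.PropositionalEquality using (_≡_; refl; sym; trans; cong; cong₂)

open Equivalence using (to; from)

Sat-∀* : ∀ {L ℓ} (M : Structure L ℓ) k (φ : Formula L k) →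
         (∀ ρ → Sat M φ ρ) → ∀ ρ → Sat M (∀* k φ) ρ
Sat-∀* M zero    φ h = h
Sat-∀* M (suc k) φ h = Sat-∀* M k (∀' φ) (λ ρ a → h (ext M a ρ))

Sat-⋀ : ∀ {L ℓ k} (M : Structure L ℓ) (ρ : Fin k → Carrier M) n (F : Fin n → Formula L k) →
        Sat M (⋀ n F) ρ ⟺ (∀ i → Sat M (F i) ρ)
Sat-⋀ M ρ zero    F = mk⇔ (λ _ ()) (λ _ → lift tt)
Sat-⋀ M ρ (suc n) F = mk⇔
  (λ { (a , as) → λ { zero → a ; (suc i) → to ih as i } })
  (λ h → h zero , from ih (h ∘ suc))
  where ih = Sat-⋀ M ρ n (F ∘ suc)

∀-distrib-× : ∀ {a ℓ} {A : Set a} {P Q : A → Set ℓ} →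
              ((∀ i → P i) × (∀ i → Q i)) ⟺ (∀ i → P i × Q i)
∀-distrib-× = mk⇔ (λ (p , q) i → p i , q i) (λ h → proj₁ ∘ h , proj₂ ∘ h)

∀-cong-⟺ : ∀ {a ℓ} {A : Set a} {P Q : A → Set ℓ} → (∀ i → P i ⟺ Q i) → (∀ i → P i) ⟺ (∀ i → Q i)
∀-cong-⟺ h = mk⇔ (λ p i → to (h i) (p i)) (λ q i → from (h i) (q i))

trF-⋀ : ∀ {L k} n (F : Fin n → Formula L k) → trF (⋀ n F) ≡ ⋀ n (trF ∘ F)
trF-⋀ zero    F = refl
trF-⋀ (suc n) F = cong (trF (F zero) ∧'_) (trF-⋀ n (F ∘ suc))

trTs-map-var : ∀ {L N a} (u : Vec (Fin N) a) → trTs {L} (map var u) ≡ map var u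
trTs-map-var []      = refl
trTs-map-var (x ∷ u) = cong (var x ∷_) (trTs-map-var u)

IsUniformConfig-⋀ : ∀ {L k} n (F : Fin n → Formula (LSk L) k) →
                    (∀ i → IsUniformConfig (F i)) → IsUniformConfig (⋀ n F)
IsUniformConfig-⋀ zero    F h = uc⊤
IsUniformConfig-⋀ (suc n) F h = uc∧ (h zero) (IsUniformConfig-⋀ n (F ∘ suc) (h ∘ suc))

record Decomposition (L : Language) (N : ℕ) (G : Formula (LSk L) N) : Setω where
  field
    φ       : Formula L N
    χ       : Formula (LSk L) N
    uniform : IsUniformConfig χ
    sound   : ∀ {ℓ} (M : Structure (LSk L) ℓ) ρ → Sat M (trF φ ∧' χ) ρ ⟺ Sat M G ρ
open Decomposition

Decomposition-cong : ∀ {L N} {G G′ : Formula (LSk L) N} →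
                     G ≡ G′ → Decomposition L N G → Decomposition L N G′
Decomposition-cong refl D = D

Decomposition-trF : ∀ {L N} (ψ : Formula L N) → Decomposition L N (trF ψ)
Decomposition-trF ψ = record
  { φ = ψ ; χ = ⊤' ; uniform = uc⊤ ; sound = λ M ρ → mk⇔ proj₁ (_, lift tt) }

Decomposition-graph : ∀ {L N a} (y : Fin N) (u : Vec (Fin N) a)
                      (g : Func (LSk L)) (e : a ≡ arity (LSk L) g) →
                      Decomposition L N (var y ≐ app≡ g e (map var u))
Decomposition-graph y u (inj₁ g) refl =
  Decomposition-cong (cong (λ v → var y ≐ app (inj₁ g) v) (trTs-map-var u))
                     (Decomposition-trF (var y ≐ app g (map var u)))
Decomposition-graph y u (inj₂ s) refl = record
  { φ       = ⊤'
  ; χ       = app (inj₂ s) (map var u) ≐ var y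
  ; uniform = ucEq s u y
  ; sound   = λ M ρ → mk⇔ (sym ∘ proj₂) (λ p → lift tt , sym p)
  }

Decomposition-⋀ : ∀ {L N} n (G : Fin n → Formula (LSk L) N) →
                  (∀ i → Decomposition L N (G i)) → Decomposition L N (⋀ n G)
Decomposition-⋀ {L} {N} n G D = record
  { φ       = ⋀ n Φ
  ; χ       = ⋀ n X
  ; uniform = IsUniformConfig-⋀ n X (λ i → uniform (D i))
  ; sound   = sound-⋀
  }
  where
  Φ : Fin n → Formula L N
  Φ i = φ (D i)

  X : Fin n → Formula (LSk L) N
  X i = χ (D i)

  sound-⋀ : ∀ {ℓ} (M : Structure (LSk L) ℓ) ρ →
            Sat M (trF (⋀ n Φ) ∧' ⋀ n X) ρ ⟺ Sat M (⋀ n G) ρ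
  sound-⋀ {ℓ} M ρ = begin
    (Sat M (trF (⋀ n Φ)) ρ × Sat M (⋀ n X) ρ)
      ≡⟨ cong (λ F → Sat M F ρ × Sat M (⋀ n X) ρ) (trF-⋀ n Φ) ⟩
    (Sat M (⋀ n (trF ∘ Φ)) ρ × Sat M (⋀ n X) ρ)
      ≈⟨ Sat-⋀ M ρ n (trF ∘ Φ) ×-⇔ Sat-⋀ M ρ n X ⟩
    ((∀ i → Sat M (trF (Φ i)) ρ) × (∀ i → Sat M (X i) ρ))
      ≈⟨ ∀-distrib-× ⟩
    (∀ i → Sat M (trF (Φ i)) ρ × Sat M (X i) ρ)
      ≈⟨ ∀-cong-⟺ (λ i → sound (D i) M ρ) ⟩
    (∀ i → Sat M (G i) ρ)
      ≈⟨ Sat-⋀ M ρ n G ⟨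
    Sat M (⋀ n G) ρ ∎
    where open import Relation.Binary.Reasoning.Setoid (⇔-setoid ℓ)

prefixVars : ∀ m n (i : Fin n) → Vec (Fin (m + n)) (m + toℕ i)
prefixVars m n i = tabulate (_↑ˡ n) ++ tabulate (λ j → m ↑ʳ inject j)

map-var-prefixVars : ∀ {L} m n (i : Fin n) → map var (prefixVars m n i) ≡ xVars {L} m n ++ yPrefix m i
map-var-prefixVars m n i =
  trans (map-++ var (tabulate (_↑ˡ n)) (tabulate (λ j → m ↑ʳ inject j)))
        (sym (cong₂ _++_ (tabulate-∘ var (_↑ˡ n)) (tabulate-∘ var (λ j → m ↑ʳ inject j))))

lemma4p3 : (L : Language) (T : Theory L) (m n : ℕ)
    (f : Fin n → Func (LSk L))
    (ar : (i : Fin n) → m + toℕ i ≡ arity (LSk L) (f i))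
    (t : Fin n → Term (LSk L) m) →
    ((i : Fin n) → t i ≡ app≡ (f i) (ar i) (tabulate var ++ tabulate (λ j → t (inject j)))) →
    Σω (Formula L (m + n)) (λ φ →
      Σω (Formula (LSk L) (m + n)) (λ χ →
        Σω (IsUniformConfig χ) (λ _ →
          Skolem₊ T ⊨ ∀* (m + n)
            ((trF φ ∧' χ) ⇔
             ⋀ n (λ i → var (m ↑ʳ i) ≐ app≡ (f i) (ar i) (xVars m n ++ yPrefix m i))))))
lemma4p3 L T m n f ar t _ =
  φ D ,ω (χ D ,ω (uniform D ,ω λ M _ →
    Sat-∀* M (m + n) _ (λ ρ → to (sound D M ρ) , from (sound D M ρ)) (λ ())))
  where
  equation : Fin n → Formula (LSk L) (m + n)
  equation i = var (m ↑ʳ i) ≐ app≡ (f i) (ar i) (xVars m n ++ yPrefix m i)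

  D : Decomposition L (m + n) (⋀ n equation)
  D = Decomposition-⋀ n equation λ i →
        Decomposition-cong (cong (λ v → var (m ↑ʳ i) ≐ app≡ (f i) (ar i) v) (map-var-prefixVars m n i))
                           (Decomposition-graph (m ↑ʳ i) (prefixVars m n i) (f i) (ar i))
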